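{- The triple $(\mathbb{L}\mathrm{Vir},\partial,\int)$ of virtual linear species with their derivative and integral is an integro-differential ring (of weight $0$).
   Context: A linear species $F$ is a functor from the category of finite totally ordered sets with increasing bijections to finite sets; linear species are identified up to natural isomorphism. For totally ordered $\ell$: $(F+G)[\ell]=F[\ell]\sqcup G[\ell]$; $(FG)[\ell]=\bigsqcup_{\ell_1+\ell_2=\ell}F[\ell_1]\times G[\ell_2]$ (decompositions of the underlying set into two parts with the restricted orders); the derivative is $\partial F[\ell]=F[1\oplus\ell]$, where $1\oplus\ell$ adjoins a new minimum; the integral is $(\int F)[\ell]=\emptyset$ if $\ell=\emptyset$ and $F[\ell\setminus m_\ell]$ otherwise, $m_\ell$ the minimum of $\ell$. $\mathbb{L}\mathrm{Vir}$ is the ring of virtual linear species: formal differences $F-G$ of linear species modulo $F-G=H-K$ iff $F+K\cong G+H$, with sum, product, $\partial$ and $\int$ extended by additivity. An integro-differential ring (of weight $0$) is a commutative ring $R$ with an additive $\partial$ satisfying $\partial(xy)=\partial(x)y+x\partial(y)$ and an additive $\int$ with $\partial\int=\mathrm{id}_R$ and $\int\big(\partial(x)\int y\big)=x\int y-\int(xy)$ for all $x,y\in R$. -}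

module Defs where

open import Level using (Level; 0ℓ) renaming (suc to lsuc)
open import Data.Nat using (ℕ; zero; suc)
import Data.Nat as ℕ
open import Data.Bool using (Bool; true; false)
open import Data.Fin using (Fin)
open import Data.Fin.Properties using (+↔⊎; *↔×; 0↔⊥; 1↔⊤)
open import Data.Fin.Subset using (Subset; ∣_∣; ∁)
open import Data.Vec using (Vec; []; _∷_)
open import Data.Empty using (⊥)
open import Data.Unit using (⊤; tt)
open import Data.Sum using (_⊎_; inj₁; inj₂)
open import Data.Product using (Σ; _×_; _,_; proj₁; proj₂)
open import Data.Sum.Function.Propositional using (_⊎-↔_)
open import Data.Product.Function.NonDependent.Propositional using (_×-↔_)
open import Function.Bundles using (_↔_; mk↔ₛ′)
open import Function.Properties.Inverse using (↔-refl; ↔-sym; ↔-trans)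
open import Relation.Binary.PropositionalEquality using (_≡_; refl)
open import Algebra.Structures using (IsCommutativeRing)

IsFinite : Set → Set
IsFinite A = Σ ℕ λ k → A ↔ Fin k

⊥-finite : IsFinite ⊥
⊥-finite = 0 , ↔-sym 0↔⊥

⊤-finite : IsFinite ⊤
⊤-finite = 1 , ↔-sym 1↔⊤

⊎-finite : {A B : Set} → IsFinite A → IsFinite B → IsFinite (A ⊎ B)
⊎-finite (m , f) (n , g) = m ℕ.+ n , ↔-trans (f ⊎-↔ g) (↔-sym +↔⊎)

×-finite : {A B : Set} → IsFinite A → IsFinite B → IsFinite (A × B)
×-finite (m , f) (n , g) = m ℕ.* n , ↔-trans (f ×-↔ g) (↔-sym *↔×)

Σ-subset-finite : (n : ℕ) (P : Subset n → Set) →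
                  ((S : Subset n) → IsFinite (P S)) → IsFinite (Σ (Subset n) P)
Σ-subset-finite zero P fP = proj₁ (fP []) , ↔-trans iso (proj₂ (fP []))
  where
  iso : Σ (Subset zero) P ↔ P []
  iso = mk↔ₛ′ (λ { ([] , p) → p }) (λ p → [] , p) (λ _ → refl) (λ { ([] , p) → refl })
Σ-subset-finite (suc n) P fP =
  proj₁ fin , ↔-trans iso (proj₂ fin)
  where
  fin = ⊎-finite (Σ-subset-finite n (λ S → P (true ∷ S)) (λ S → fP (true ∷ S)))
                 (Σ-subset-finite n (λ S → P (false ∷ S)) (λ S → fP (false ∷ S)))
  to : Σ (Subset (suc n)) P → Σ (Subset n) (λ S → P (true ∷ S)) ⊎ Σ (Subset n) (λ S → P (false ∷ S))
  to (true ∷ S , p) = inj₁ (S , p)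
  to (false ∷ S , p) = inj₂ (S , p)
  from : Σ (Subset n) (λ S → P (true ∷ S)) ⊎ Σ (Subset n) (λ S → P (false ∷ S)) → Σ (Subset (suc n)) P
  from (inj₁ (S , p)) = true ∷ S , p
  from (inj₂ (S , p)) = false ∷ S , p
  iso : Σ (Subset (suc n)) P ↔ (Σ (Subset n) (λ S → P (true ∷ S)) ⊎ Σ (Subset n) (λ S → P (false ∷ S)))
  iso = mk↔ₛ′ to from (λ { (inj₁ _) → refl ; (inj₂ _) → refl })
                      (λ { (true ∷ S , p) → refl ; (false ∷ S , p) → refl })

-- Every finite totally ordered set ℓ with |ℓ| = n is uniquely (by an
-- increasing bijection) isomorphic to Fin n with its usual order, and the
-- only increasing bijection Fin n → Fin n is the identity.  Hence the
-- category of finite totally ordered sets with increasing bijections is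
-- equivalent to its skeleton, the discrete category ℕ (object n = Fin n),
-- and a linear species is (up to natural isomorphism) a family of finite
-- sets indexed by ℕ; F[Fin n] is written  obj F n.

record LinSpecies : Set₁ where
  field
    obj    : ℕ → Set
    finite : (n : ℕ) → IsFinite (obj n)
open LinSpecies public

-- Natural isomorphism (naturality is automatic: the only morphisms of the
-- skeleton are identities).
_≅_ : LinSpecies → LinSpecies → Set
F ≅ G = (n : ℕ) → obj F n ↔ obj G n

𝟘 : LinSpecies
𝟘 = record { obj = λ _ → ⊥ ; finite = λ _ → ⊥-finite }

𝟙 : LinSpecies
obj 𝟙 zero = ⊤
obj 𝟙 (suc _) = ⊥
finite 𝟙 zero = ⊤-finite
finite 𝟙 (suc _) = ⊥-finite

_⊕_ : LinSpecies → LinSpecies → LinSpecies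
obj (F ⊕ G) n = obj F n ⊎ obj G n
finite (F ⊕ G) n = ⊎-finite (finite F n) (finite G n)

-- (F G)[ℓ] = ⊔_{ℓ₁ + ℓ₂ = ℓ} F[ℓ₁] × G[ℓ₂]: a decomposition of Fin n into
-- two parts is a subset S (ℓ₁ = S, ℓ₂ = ∁ S) and S, ∁ S with the
-- restricted order are Fin ∣ S ∣ and Fin ∣ ∁ S ∣.
_⊗_ : LinSpecies → LinSpecies → LinSpecies
obj (F ⊗ G) n = Σ (Subset n) λ S → obj F ∣ S ∣ × obj G ∣ ∁ S ∣
finite (F ⊗ G) n =
  Σ-subset-finite n _ (λ S → ×-finite (finite F ∣ S ∣) (finite G ∣ ∁ S ∣))

-- ∂F[ℓ] = F[1 ⊕ ℓ]  (adjoin a new minimum: Fin n ↦ Fin (suc n))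
∂ˢ : LinSpecies → LinSpecies
obj (∂ˢ F) n = obj F (suc n)
finite (∂ˢ F) n = finite F (suc n)

-- (∫F)[∅] = ∅,  (∫F)[ℓ] = F[ℓ ∖ min ℓ]  (Fin (suc n) ∖ min ≅ Fin n)
∫ˢ : LinSpecies → LinSpecies
obj (∫ˢ F) zero = ⊥
obj (∫ˢ F) (suc n) = obj F n
finite (∫ˢ F) zero = ⊥-finite
finite (∫ˢ F) (suc n) = finite F n

-- Virtual linear species: formal differences F - G, represented as pairs
-- (F , G), with (F , G) ≈ (H , K) iff F + K ≅ G + H.

LVir : Set₁
LVir = LinSpecies × LinSpecies

_≈ᵛ_ : LVir → LVir → Set
(F , G) ≈ᵛ (H , K) = (F ⊕ K) ≅ (G ⊕ H)

_+ᵛ_ : LVir → LVir → LVir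
(F , G) +ᵛ (H , K) = (F ⊕ H , G ⊕ K)

-- (F - G)(H - K) = (FH + GK) - (FK + GH)
_*ᵛ_ : LVir → LVir → LVir
(F , G) *ᵛ (H , K) = ((F ⊗ H) ⊕ (G ⊗ K) , (F ⊗ K) ⊕ (G ⊗ H))

-ᵛ_ : LVir → LVir
-ᵛ (F , G) = (G , F)

0ᵛ : LVir
0ᵛ = (𝟘 , 𝟘)

1ᵛ : LVir
1ᵛ = (𝟙 , 𝟘)

∂ᵛ : LVir → LVir
∂ᵛ (F , G) = (∂ˢ F , ∂ˢ G)

∫ᵛ : LVir → LVir
∫ᵛ (F , G) = (∫ˢ F , ∫ˢ G)

record IsIntegroDifferentialRing {c ℓ : Level} {A : Set c}
         (_≈_ : A → A → Set ℓ) (_+_ _*_ : A → A → A) (-_ : A → A) (0# 1# : A)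
         (∂ ∫ : A → A) : Set (c Level.⊔ ℓ) where
  field
    isCommutativeRing : IsCommutativeRing _≈_ _+_ _*_ -_ 0# 1#
    ∂-cong    : ∀ {x y} → x ≈ y → ∂ x ≈ ∂ y
    ∂-additive : ∀ x y → ∂ (x + y) ≈ (∂ x + ∂ y)
    ∂-leibniz : ∀ x y → ∂ (x * y) ≈ ((∂ x * y) + (x * ∂ y))
    ∫-cong    : ∀ {x y} → x ≈ y → ∫ x ≈ ∫ y
    ∫-additive : ∀ x y → ∫ (x + y) ≈ (∫ x + ∫ y)
    ∂∫≈id     : ∀ x → ∂ (∫ x) ≈ x
    ∫-parts   : ∀ x y → ∫ (∂ x * ∫ y) ≈ ((x * ∫ y) + (- ∫ (x * y)))

module Submission where

-- Counting structures, n ↦ ∣F[n]∣, sends a virtual species to an integer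
-- sequence, and linear species with the same counting sequence are
-- isomorphic, so this map is injective on LVir.  It turns sum and product
-- of species into the sum and the binomial convolution of sequences (a
-- subset of {0,…,n} contains the minimum or not), the derivative into the
-- shift and the integral into the right shift with constant term 0.  So
-- LVir embeds into the Hurwitz series over ℤ, compatibly with ∂ and ∫, and
-- Hurwitz series over any commutative ring form an integro-differential
-- ring: Leibniz and ∂∫ = id hold by definition of the convolution, and
-- integration by parts is a one-line computation.

open import Level using (0ℓ) renaming (suc to lsuc)
open import Algebra.Bundles using (Ring; CommutativeRing)
open import Algebra.Bundles.Raw using (RawRing)
open import Algebra.Structures using (IsCommutativeRing)
open import Algebra.Morphism.Structures using (IsRingMonomorphism)
import Algebra.Morphism.RingMonomorphism as RingMonomorphism
import Algebra.Construct.Pointwise as Pointwise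
import Algebra.Properties.Ring as RingProperties
open import Algebra.Properties.CommutativeSemigroup using (interchange)
open import Data.Nat using (ℕ; zero; suc)
open import Data.Integer using (ℤ; +_) renaming (_+_ to _+ℤ_; _-_ to _-ℤ_; -_ to -ℤ_)
open import Data.Integer.Properties
  using (pos-+; pos-*; +-injective; i≡j⇒i-j≡0; i-j≡0⇒i≡j; +-*-commutativeRing)
open import Data.Integer.Tactic.RingSolver using (solve-∀)
open import Data.Fin.Permutation using (↔⇒≡)
open import Data.Product using (_,_; proj₁)
open import Function.Bundles using (_↔_; _⇔_; mk⇔; Equivalence)
open import Function.Properties.Inverse using (↔-sym; ↔-trans)
open import Relation.Binary.Core using (Rel)
open import Relation.Binary.PropositionalEquality using (_≡_)
import Relation.Binary.PropositionalEquality as ≡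
import Relation.Binary.Reasoning.Setoid as SetoidReasoning
open import Defs

module _ {r ℓ} (R : Ring r ℓ) where
  open Ring R
  open RingProperties R using ([y-z]x≈yx-zx; x[y-z]≈xy-xz; ⁻¹-anti-homo‿-; -‿+-comm)
  open SetoidReasoning setoid

  [w-x][y-z]≈[wy+xz]-[wz+xy] : ∀ w x y z →
                               (w - x) * (y - z) ≈ (w * y + x * z) - (w * z + x * y)
  [w-x][y-z]≈[wy+xz]-[wz+xy] w x y z = begin
    (w - x) * (y - z)                      ≈⟨ [y-z]x≈yx-zx (y - z) w x ⟩
    w * (y - z) - x * (y - z)              ≈⟨ +-cong (x[y-z]≈xy-xz w y z)
                                                     (-‿cong (x[y-z]≈xy-xz x y z)) ⟩
    (w * y - w * z) - (x * y - x * z)      ≈⟨ +-congˡ (⁻¹-anti-homo‿- (x * y) (x * z)) ⟩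
    (w * y - w * z) + (x * z - x * y)      ≈⟨ interchange +-commutativeSemigroup _ _ _ _ ⟩
    (w * y + x * z) + (- (w * z) - x * y)  ≈⟨ +-congˡ (-‿+-comm (w * z) (x * y)) ⟩
    (w * y + x * z) - (w * z + x * y)      ∎

module HurwitzSeries {c ℓ} (R : CommutativeRing c ℓ) where

  open CommutativeRing R hiding (isCommutativeRing)
  open RingProperties ring using (-0#≈0#; //-rightDividesʳ)
  open SetoidReasoning setoid

  Series : Set c
  Series = ℕ → Carrier

  infix  4 _≋_
  infixl 7 _⋆_
  infixl 6 _⊞_

  _≋_ : Rel Series ℓ
  a ≋ b = ∀ n → a n ≈ b n

  _⊞_ : Series → Series → Series
  (a ⊞ b) n = a n + b n

  ⊟_ : Series → Series
  (⊟ a) n = - a n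

  𝟎 : Series
  𝟎 _ = 0#

  δ : Series
  δ zero    = 1#
  δ (suc _) = 0#

  shift : Series → Series
  shift a n = a (suc n)

  integral : Series → Series
  integral a zero    = 0#
  integral a (suc n) = a n

  -- Binomial convolution, (a ⋆ b) n = Σₖ C(n,k) a k b (n ∸ k), in the form
  -- of the Leibniz rule for shift.
  _⋆_ : Series → Series → Series
  (a ⋆ b) zero    = a 0 * b 0
  (a ⋆ b) (suc n) = (shift a ⋆ b) n + (a ⋆ shift b) n

  ⋆-cong : ∀ {a a′ b b′} → a ≋ a′ → b ≋ b′ → a ⋆ b ≋ a′ ⋆ b′
  ⋆-cong a≋a′ b≋b′ zero    = *-cong (a≋a′ 0) (b≋b′ 0)
  ⋆-cong a≋a′ b≋b′ (suc n) =
    +-cong (⋆-cong (λ k → a≋a′ (suc k)) b≋b′ n) (⋆-cong a≋a′ (λ k → b≋b′ (suc k)) n)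

  ⋆-comm : ∀ a b → a ⋆ b ≋ b ⋆ a
  ⋆-comm a b zero    = *-comm (a 0) (b 0)
  ⋆-comm a b (suc n) = begin
    (shift a ⋆ b) n + (a ⋆ shift b) n ≈⟨ +-cong (⋆-comm (shift a) b n) (⋆-comm a (shift b) n) ⟩
    (b ⋆ shift a) n + (shift b ⋆ a) n ≈⟨ +-comm _ _ ⟩
    (shift b ⋆ a) n + (b ⋆ shift a) n ∎

  ⋆-distribˡ-⊞ : ∀ a b c → a ⋆ (b ⊞ c) ≋ a ⋆ b ⊞ a ⋆ c
  ⋆-distribˡ-⊞ a b c zero    = distribˡ (a 0) (b 0) (c 0)
  ⋆-distribˡ-⊞ a b c (suc n) = begin
    (shift a ⋆ (b ⊞ c)) n + (a ⋆ (shift b ⊞ shift c)) n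
      ≈⟨ +-cong (⋆-distribˡ-⊞ (shift a) b c n) (⋆-distribˡ-⊞ a (shift b) (shift c) n) ⟩
    ((shift a ⋆ b) n + (shift a ⋆ c) n) + ((a ⋆ shift b) n + (a ⋆ shift c) n)
      ≈⟨ interchange +-commutativeSemigroup _ _ _ _ ⟩
    ((shift a ⋆ b) n + (a ⋆ shift b) n) + ((shift a ⋆ c) n + (a ⋆ shift c) n) ∎

  ⋆-distribʳ-⊞ : ∀ a b c → (b ⊞ c) ⋆ a ≋ b ⋆ a ⊞ c ⋆ a
  ⋆-distribʳ-⊞ a b c n = begin
    ((b ⊞ c) ⋆ a) n           ≈⟨ ⋆-comm (b ⊞ c) a n ⟩
    (a ⋆ (b ⊞ c)) n           ≈⟨ ⋆-distribˡ-⊞ a b c n ⟩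
    (a ⋆ b) n + (a ⋆ c) n     ≈⟨ +-cong (⋆-comm a b n) (⋆-comm a c n) ⟩
    (b ⋆ a) n + (c ⋆ a) n     ∎

  ⋆-zeroˡ : ∀ a → 𝟎 ⋆ a ≋ 𝟎
  ⋆-zeroˡ a zero    = zeroˡ (a 0)
  ⋆-zeroˡ a (suc n) = begin
    (𝟎 ⋆ a) n + (𝟎 ⋆ shift a) n ≈⟨ +-cong (⋆-zeroˡ a n) (⋆-zeroˡ (shift a) n) ⟩
    0# + 0#                     ≈⟨ +-identityˡ 0# ⟩
    0#                          ∎

  -- shift δ is 𝟎 definitionally, whence the summand 𝟎 ⋆ a below.
  ⋆-identityˡ : ∀ a → δ ⋆ a ≋ a
  ⋆-identityˡ a zero    = *-identityˡ (a 0)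
  ⋆-identityˡ a (suc n) = begin
    (𝟎 ⋆ a) n + (δ ⋆ shift a) n ≈⟨ +-cong (⋆-zeroˡ a n) (⋆-identityˡ (shift a) n) ⟩
    0# + a (suc n)              ≈⟨ +-identityˡ (a (suc n)) ⟩
    a (suc n)                   ∎

  ⋆-identityʳ : ∀ a → a ⋆ δ ≋ a
  ⋆-identityʳ a n = trans (⋆-comm a δ n) (⋆-identityˡ a n)

  ⋆-assoc : ∀ a b c → (a ⋆ b) ⋆ c ≋ a ⋆ (b ⋆ c)
  ⋆-assoc a b c zero    = *-assoc (a 0) (b 0) (c 0)
  ⋆-assoc a b c (suc n) = begin
    ((shift a ⋆ b ⊞ a ⋆ shift b) ⋆ c) n + ((a ⋆ b) ⋆ shift c) n
      ≈⟨ +-congʳ (⋆-distribʳ-⊞ c (shift a ⋆ b) (a ⋆ shift b) n) ⟩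
    (((shift a ⋆ b) ⋆ c) n + ((a ⋆ shift b) ⋆ c) n) + ((a ⋆ b) ⋆ shift c) n
      ≈⟨ +-cong (+-cong (⋆-assoc (shift a) b c n) (⋆-assoc a (shift b) c n))
                (⋆-assoc a b (shift c) n) ⟩
    ((shift a ⋆ (b ⋆ c)) n + (a ⋆ (shift b ⋆ c)) n) + (a ⋆ (b ⋆ shift c)) n
      ≈⟨ +-assoc _ _ _ ⟩
    (shift a ⋆ (b ⋆ c)) n + ((a ⋆ (shift b ⋆ c)) n + (a ⋆ (b ⋆ shift c)) n)
      ≈⟨ +-congˡ (⋆-distribˡ-⊞ a (shift b ⋆ c) (b ⋆ shift c) n) ⟨
    (shift a ⋆ (b ⋆ c)) n + (a ⋆ (shift b ⋆ c ⊞ b ⋆ shift c)) n ∎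

  isCommutativeRing : IsCommutativeRing _≋_ _⊞_ _⋆_ ⊟_ 𝟎 δ
  isCommutativeRing = record
    { isRing = record
      { +-isAbelianGroup = Pointwise.isAbelianGroup ℕ +-isAbelianGroup
      ; *-cong           = ⋆-cong
      ; *-assoc          = ⋆-assoc
      ; *-identity       = ⋆-identityˡ , ⋆-identityʳ
      ; distrib          = ⋆-distribˡ-⊞ , ⋆-distribʳ-⊞
      }
    ; *-comm = ⋆-comm
    }

  integral-parts : ∀ a b →
                   integral (shift a ⋆ integral b) ≋ a ⋆ integral b ⊞ ⊟ integral (a ⋆ b)
  integral-parts a b zero = begin
    0#                ≈⟨ zeroʳ (a 0) ⟨
    a 0 * 0#          ≈⟨ +-identityʳ _ ⟨
    a 0 * 0# + 0#     ≈⟨ +-congˡ -0#≈0# ⟨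
    a 0 * 0# + - 0#   ∎
  -- shift (integral b) is b definitionally, so this is (p + q) - q ≈ p.
  integral-parts a b (suc n) = sym (//-rightDividesʳ ((a ⋆ b) n) ((shift a ⋆ integral b) n))

  isIntegroDifferentialRing : IsIntegroDifferentialRing _≋_ _⊞_ _⋆_ ⊟_ 𝟎 δ shift integral
  isIntegroDifferentialRing = record
    { isCommutativeRing = isCommutativeRing
    ; ∂-cong            = λ a≋b n → a≋b (suc n)
    ; ∂-additive        = λ _ _ _ → refl
    ; ∂-leibniz         = λ _ _ _ → refl
    ; ∫-cong            = λ { a≋b zero → refl ; a≋b (suc n) → a≋b n }
    ; ∫-additive        = λ { _ _ zero → sym (+-identityˡ 0#) ; _ _ (suc _) → refl }
    ; ∂∫≈id             = λ _ _ → refl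
    ; ∫-parts           = integral-parts
    }

  commutativeRing : CommutativeRing c ℓ
  commutativeRing = record { isCommutativeRing = isCommutativeRing }

module IntegroDifferentialPullback
  {a b ℓ₁ ℓ₂} {R₁ : RawRing a ℓ₁} {R₂ : RawRing b ℓ₂}
  {⟦_⟧ : RawRing.Carrier R₁ → RawRing.Carrier R₂}
  (isRingMonomorphism : IsRingMonomorphism R₁ R₂ ⟦_⟧)
  {∂₁ ∫₁ : RawRing.Carrier R₁ → RawRing.Carrier R₁}
  {∂₂ ∫₂ : RawRing.Carrier R₂ → RawRing.Carrier R₂}
  (∂-homo : ∀ x → RawRing._≈_ R₂ ⟦ ∂₁ x ⟧ (∂₂ ⟦ x ⟧))
  (∫-homo : ∀ x → RawRing._≈_ R₂ ⟦ ∫₁ x ⟧ (∫₂ ⟦ x ⟧))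
  (isIntegroDifferentialRing₂ : IsIntegroDifferentialRing (RawRing._≈_ R₂) (RawRing._+_ R₂)
     (RawRing._*_ R₂) (RawRing.-_ R₂) (RawRing.0# R₂) (RawRing.1# R₂) ∂₂ ∫₂)
  where

  open RawRing R₁ renaming (Carrier to A)
  open RawRing R₂ using () renaming
    (Carrier to B; _≈_ to _≈₂_; _+_ to _+₂_; _*_ to _*₂_; -_ to -₂_)
  open IsRingMonomorphism isRingMonomorphism
  module D = IsIntegroDifferentialRing isIntegroDifferentialRing₂
  module C = IsCommutativeRing D.isCommutativeRing
  open SetoidReasoning C.setoid

  module _ {f : A → A} {g : B → B} (f-homo : ∀ x → ⟦ f x ⟧ ≈₂ g ⟦ x ⟧) where

    pullback-cong : (∀ {u v} → u ≈₂ v → g u ≈₂ g v) → ∀ {x y} → x ≈ y → f x ≈ f y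
    pullback-cong g-cong {x} {y} x≈y = injective (begin
      ⟦ f x ⟧  ≈⟨ f-homo x ⟩
      g ⟦ x ⟧  ≈⟨ g-cong (⟦⟧-cong x≈y) ⟩
      g ⟦ y ⟧  ≈⟨ f-homo y ⟨
      ⟦ f y ⟧  ∎)

    pullback-additive : (∀ {u v} → u ≈₂ v → g u ≈₂ g v) →
                        (∀ u v → g (u +₂ v) ≈₂ g u +₂ g v) →
                        ∀ x y → f (x + y) ≈ f x + f y
    pullback-additive g-cong g-additive x y = injective (begin
      ⟦ f (x + y) ⟧        ≈⟨ f-homo (x + y) ⟩
      g ⟦ x + y ⟧          ≈⟨ g-cong (+-homo x y) ⟩
      g (⟦ x ⟧ +₂ ⟦ y ⟧)   ≈⟨ g-additive ⟦ x ⟧ ⟦ y ⟧ ⟩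
      g ⟦ x ⟧ +₂ g ⟦ y ⟧   ≈⟨ C.+-cong (f-homo x) (f-homo y) ⟨
      ⟦ f x ⟧ +₂ ⟦ f y ⟧   ≈⟨ +-homo (f x) (f y) ⟨
      ⟦ f x + f y ⟧        ∎)

  ∂-leibniz : ∀ x y → ∂₁ (x * y) ≈ ∂₁ x * y + x * ∂₁ y
  ∂-leibniz x y = injective (begin
    ⟦ ∂₁ (x * y) ⟧                          ≈⟨ ∂-homo (x * y) ⟩
    ∂₂ ⟦ x * y ⟧                            ≈⟨ D.∂-cong (*-homo x y) ⟩
    ∂₂ (⟦ x ⟧ *₂ ⟦ y ⟧)                     ≈⟨ D.∂-leibniz ⟦ x ⟧ ⟦ y ⟧ ⟩
    ∂₂ ⟦ x ⟧ *₂ ⟦ y ⟧ +₂ ⟦ x ⟧ *₂ ∂₂ ⟦ y ⟧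
      ≈⟨ C.+-cong (C.*-congʳ (∂-homo x)) (C.*-congˡ (∂-homo y)) ⟨
    ⟦ ∂₁ x ⟧ *₂ ⟦ y ⟧ +₂ ⟦ x ⟧ *₂ ⟦ ∂₁ y ⟧  ≈⟨ C.+-cong (*-homo (∂₁ x) y) (*-homo x (∂₁ y)) ⟨
    ⟦ ∂₁ x * y ⟧ +₂ ⟦ x * ∂₁ y ⟧            ≈⟨ +-homo (∂₁ x * y) (x * ∂₁ y) ⟨
    ⟦ ∂₁ x * y + x * ∂₁ y ⟧                 ∎)

  ∂∫≈id : ∀ x → ∂₁ (∫₁ x) ≈ x
  ∂∫≈id x = injective (begin
    ⟦ ∂₁ (∫₁ x) ⟧   ≈⟨ ∂-homo (∫₁ x) ⟩
    ∂₂ ⟦ ∫₁ x ⟧     ≈⟨ D.∂-cong (∫-homo x) ⟩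
    ∂₂ (∫₂ ⟦ x ⟧)   ≈⟨ D.∂∫≈id ⟦ x ⟧ ⟩
    ⟦ x ⟧           ∎)

  ∫-parts : ∀ x y → ∫₁ (∂₁ x * ∫₁ y) ≈ x * ∫₁ y + - ∫₁ (x * y)
  ∫-parts x y = injective (begin
    ⟦ ∫₁ (∂₁ x * ∫₁ y) ⟧
      ≈⟨ ∫-homo (∂₁ x * ∫₁ y) ⟩
    ∫₂ ⟦ ∂₁ x * ∫₁ y ⟧
      ≈⟨ D.∫-cong (C.trans (*-homo (∂₁ x) (∫₁ y)) (C.*-cong (∂-homo x) (∫-homo y))) ⟩
    ∫₂ (∂₂ ⟦ x ⟧ *₂ ∫₂ ⟦ y ⟧)
      ≈⟨ D.∫-parts ⟦ x ⟧ ⟦ y ⟧ ⟩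
    ⟦ x ⟧ *₂ ∫₂ ⟦ y ⟧ +₂ -₂ ∫₂ (⟦ x ⟧ *₂ ⟦ y ⟧)
      ≈⟨ C.+-cong (C.*-congˡ (∫-homo y)) (C.-‿cong (D.∫-cong (*-homo x y))) ⟨
    ⟦ x ⟧ *₂ ⟦ ∫₁ y ⟧ +₂ -₂ ∫₂ ⟦ x * y ⟧
      ≈⟨ C.+-cong (*-homo x (∫₁ y)) (C.-‿cong (∫-homo (x * y))) ⟨
    ⟦ x * ∫₁ y ⟧ +₂ -₂ ⟦ ∫₁ (x * y) ⟧
      ≈⟨ C.+-congˡ (-‿homo (∫₁ (x * y))) ⟨
    ⟦ x * ∫₁ y ⟧ +₂ ⟦ - ∫₁ (x * y) ⟧
      ≈⟨ +-homo (x * ∫₁ y) (- ∫₁ (x * y)) ⟨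
    ⟦ x * ∫₁ y + - ∫₁ (x * y) ⟧
      ∎)

  isIntegroDifferentialRing : IsIntegroDifferentialRing _≈_ _+_ _*_ -_ 0# 1# ∂₁ ∫₁
  isIntegroDifferentialRing = record
    { isCommutativeRing =
        RingMonomorphism.isCommutativeRing isRingMonomorphism D.isCommutativeRing
    ; ∂-cong            = pullback-cong ∂-homo D.∂-cong
    ; ∂-additive        = pullback-additive ∂-homo D.∂-cong D.∂-additive
    ; ∂-leibniz         = ∂-leibniz
    ; ∫-cong            = pullback-cong ∫-homo D.∫-cong
    ; ∫-additive        = pullback-additive ∫-homo D.∫-cong D.∫-additive
    ; ∂∫≈id             = ∂∫≈id
    ; ∫-parts           = ∫-parts
    }

a-b≡c-d⇔a+d≡b+c : ∀ a b c d → (a -ℤ b ≡ c -ℤ d) ⇔ (a +ℤ d ≡ b +ℤ c)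
a-b≡c-d⇔a+d≡b+c a b c d = mk⇔
  (λ eq → i-j≡0⇒i≡j _ _ (≡.trans (≡.sym (difference a b c d)) (i≡j⇒i-j≡0 eq)))
  (λ eq → i-j≡0⇒i≡j _ _ (≡.trans (difference a b c d) (i≡j⇒i-j≡0 eq)))
  where
  difference : ∀ a b c d → (a -ℤ b) -ℤ (c -ℤ d) ≡ (a +ℤ d) -ℤ (b +ℤ c)
  difference = solve-∀

size-≡⇒↔ : ∀ {A B : Set} (finA : IsFinite A) (finB : IsFinite B) →
           proj₁ finA ≡ proj₁ finB → A ↔ B
size-≡⇒↔ (m , A↔m) (n , B↔n) ≡.refl = ↔-trans A↔m (↔-sym B↔n)

↔⇒size-≡ : ∀ {A B : Set} (finA : IsFinite A) (finB : IsFinite B) →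
           A ↔ B → proj₁ finA ≡ proj₁ finB
↔⇒size-≡ (m , A↔m) (n , B↔n) A↔B = ↔⇒≡ (↔-trans (↔-sym A↔m) (↔-trans A↔B B↔n))

open HurwitzSeries +-*-commutativeRing

size : LinSpecies → ℕ → ℕ
size F n = proj₁ (finite F n)

card : LinSpecies → Series
card F n = + size F n

card-⊕ : ∀ F G → card (F ⊕ G) ≋ card F ⊞ card G
card-⊕ F G n = pos-+ (size F n) (size G n)

-- A subset of Fin (suc n) contains the minimum or not; the finiteness
-- witness of F ⊗ G is built by exactly this split, so definitionally
-- size (F ⊗ G) (suc n) = size (∂ˢ F ⊗ G) n + size (F ⊗ ∂ˢ G) n, which is the
-- recursion defining ⋆.
card-⊗ : ∀ F G → card (F ⊗ G) ≋ card F ⋆ card G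
card-⊗ F G zero    = pos-* (size F 0) (size G 0)
card-⊗ F G (suc n) = ≡.trans (pos-+ (size (∂ˢ F ⊗ G) n) (size (F ⊗ ∂ˢ G) n))
                             (≡.cong₂ _+ℤ_ (card-⊗ (∂ˢ F) G n) (card-⊗ F (∂ˢ G) n))

≅⇒card-≋ : ∀ {F G} → F ≅ G → card F ≋ card G
≅⇒card-≋ {F} {G} F≅G n = ≡.cong +_ (↔⇒size-≡ (finite F n) (finite G n) (F≅G n))

card-≋⇒≅ : ∀ {F G} → card F ≋ card G → F ≅ G
card-≋⇒≅ {F} {G} |F|≋|G| n = size-≡⇒↔ (finite F n) (finite G n) (+-injective (|F|≋|G| n))

module Hurwitzℤ = CommutativeRing commutativeRing

⟦_⟧ : LVir → Series
⟦ F , G ⟧ = card F ⊞ ⊟ card G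

⟦⟧-cong : ∀ {x y} → x ≈ᵛ y → ⟦ x ⟧ ≋ ⟦ y ⟧
⟦⟧-cong {F , G} {H , K} F+K≅G+H n =
  Equivalence.from (a-b≡c-d⇔a+d≡b+c (card F n) (card G n) (card H n) (card K n))
    (≡.trans (≡.sym (card-⊕ F K n))
      (≡.trans (≅⇒card-≋ {F ⊕ K} {G ⊕ H} F+K≅G+H n) (card-⊕ G H n)))

⟦⟧-injective : ∀ {x y} → ⟦ x ⟧ ≋ ⟦ y ⟧ → x ≈ᵛ y
⟦⟧-injective {F , G} {H , K} ⟦x⟧≋⟦y⟧ = card-≋⇒≅ {F ⊕ K} {G ⊕ H} λ n →
  ≡.trans (card-⊕ F K n) (≡.trans
    (Equivalence.to (a-b≡c-d⇔a+d≡b+c (card F n) (card G n) (card H n) (card K n)) (⟦x⟧≋⟦y⟧ n))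
    (≡.sym (card-⊕ G H n)))

⟦⟧-+ᵛ : ∀ x y → ⟦ x +ᵛ y ⟧ ≋ ⟦ x ⟧ ⊞ ⟦ y ⟧
⟦⟧-+ᵛ (F , G) (H , K) n = ≡.trans (≡.cong₂ _-ℤ_ (card-⊕ F H n) (card-⊕ G K n))
                               (rearrange (card F n) (card H n) (card G n) (card K n))
  where
  rearrange : ∀ a b c d → (a +ℤ b) -ℤ (c +ℤ d) ≡ (a -ℤ c) +ℤ (b -ℤ d)
  rearrange = solve-∀

⟦⟧-*ᵛ : ∀ x y → ⟦ x *ᵛ y ⟧ ≋ ⟦ x ⟧ ⋆ ⟦ y ⟧
⟦⟧-*ᵛ (F , G) (H , K) = begin
  card ((F ⊗ H) ⊕ (G ⊗ K)) ⊞ ⊟ card ((F ⊗ K) ⊕ (G ⊗ H))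
    ≈⟨ +-cong (card-⊗⊕⊗ F H G K) (-‿cong (card-⊗⊕⊗ F K G H)) ⟩
  (card F ⋆ card H ⊞ card G ⋆ card K) ⊞ ⊟ (card F ⋆ card K ⊞ card G ⋆ card H)
    ≈⟨ [w-x][y-z]≈[wy+xz]-[wz+xy] ring (card F) (card G) (card H) (card K) ⟨
  (card F ⊞ ⊟ card G) ⋆ (card H ⊞ ⊟ card K) ∎
  where
  open Hurwitzℤ using (+-cong; -‿cong; ring; setoid)
  open SetoidReasoning setoid

  card-⊗⊕⊗ : ∀ A B C D → card ((A ⊗ B) ⊕ (C ⊗ D)) ≋ card A ⋆ card B ⊞ card C ⋆ card D
  card-⊗⊕⊗ A B C D =
    Hurwitzℤ.trans (card-⊕ (A ⊗ B) (C ⊗ D)) (+-cong (card-⊗ A B) (card-⊗ C D))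

⟦⟧-neg : ∀ x → ⟦ -ᵛ x ⟧ ≋ ⊟ ⟦ x ⟧
⟦⟧-neg (F , G) n = negate (card F n) (card G n)
  where
  negate : ∀ a b → b -ℤ a ≡ -ℤ (a -ℤ b)
  negate = solve-∀

⟦⟧-1ᵛ : ⟦ 1ᵛ ⟧ ≋ δ
⟦⟧-1ᵛ zero    = ≡.refl
⟦⟧-1ᵛ (suc n) = ≡.refl

⟦⟧-∂ᵛ : ∀ x → ⟦ ∂ᵛ x ⟧ ≋ shift ⟦ x ⟧
⟦⟧-∂ᵛ x n = ≡.refl

⟦⟧-∫ᵛ : ∀ x → ⟦ ∫ᵛ x ⟧ ≋ integral ⟦ x ⟧
⟦⟧-∫ᵛ x zero    = ≡.refl
⟦⟧-∫ᵛ x (suc n) = ≡.refl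

LVir-rawRing : RawRing (lsuc 0ℓ) 0ℓ
LVir-rawRing = record
  { _≈_ = _≈ᵛ_ ; _+_ = _+ᵛ_ ; _*_ = _*ᵛ_ ; -_ = -ᵛ_ ; 0# = 0ᵛ ; 1# = 1ᵛ }

⟦⟧-isRingMonomorphism : IsRingMonomorphism LVir-rawRing Hurwitzℤ.rawRing ⟦_⟧
⟦⟧-isRingMonomorphism = record
  { isRingHomomorphism = record
    { isSemiringHomomorphism = record
      { isNearSemiringHomomorphism = record
        { +-isMonoidHomomorphism = record
          { isMagmaHomomorphism = record
            { isRelHomomorphism = record { cong = λ {x} {y} → ⟦⟧-cong {x} {y} }
            ; homo = ⟦⟧-+ᵛ
            }
          ; ε-homo = λ _ → ≡.refl
          }
        ; *-homo = ⟦⟧-*ᵛ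
        }
      ; 1#-homo = ⟦⟧-1ᵛ
      }
    ; -‿homo = ⟦⟧-neg
    }
  ; injective = λ {x} {y} → ⟦⟧-injective {x} {y}
  }

theorem2p37 : IsIntegroDifferentialRing _≈ᵛ_ _+ᵛ_ _*ᵛ_ -ᵛ_ 0ᵛ 1ᵛ ∂ᵛ ∫ᵛ
theorem2p37 = IntegroDifferentialPullback.isIntegroDifferentialRing
  ⟦⟧-isRingMonomorphism ⟦⟧-∂ᵛ ⟦⟧-∫ᵛ isIntegroDifferentialRing
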